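{- For every positive integer $n$ and every parking content $b\in\mathrm{PF}_\le(n)$, \[\sum_{w\in\mathfrak S_n}t^{\mathrm{exced}(\pi^{b,w})}=\sum_{w\in\mathfrak S_n}t^{\mathrm{des}(\sigma^{b,w})}.\]
   Context: A parking function of length $n$ is a sequence $\pi=(\pi_1,\dots,\pi_n)$ of positive integers whose weakly increasing rearrangement $c_1\le\dots\le c_n$ satisfies $c_j\le j$ for all $j$. A parking content is a sequence $b=(b_1,\dots,b_n)$ of positive integers with $b_1\le\dots\le b_n$ and $b_j\le j$ for all $j$; $\mathrm{PF}_\le(n)$ is the set of these. For $b\in\mathrm{PF}_\le(n)$ and $w\in\mathfrak S_n$, define $\pi^{b,w}$ by $\pi^{b,w}_i=b_{w(i)}$. Parking procedure: cars $1,\dots,n$ arrive in order at spots $1,\dots,n$; car $i$ goes to spot $\pi_i$ and, if it is occupied, moves forward to the next unoccupied spot. The parking outcome $\mathrm{oc}(\pi)\in\mathfrak S_n$ is the permutation $\sigma$ where car $i$ parks in spot $\sigma(i)$. Set $\sigma^{b,w}=\mathrm{oc}(\pi^{b,w})$. $\mathrm{exced}(\pi)=|\{i\in[n]:\pi_i>i\}|$, and for a permutation $w$, $\mathrm{des}(w)=|\{i\in[n-1]:w(i)>w(i+1)\}|$. -}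

module Defs where

open import Data.Nat using (ℕ; zero; suc; _+_; _≤_; _<_; _≟_; _<?_)
open import Data.Nat.Properties using ()
open import Data.Fin using (Fin; toℕ)
open import Data.Fin.Properties using (all?) renaming (_≟_ to _≟ᶠ_)
open import Data.List using (List; []; _∷_; length; filter; concatMap; map; allFin)
open import Data.List.Relation.Unary.Any using (any?)
open import Data.Vec using (Vec; []; _∷_; lookup; toList)
open import Relation.Nullary using (Dec; yes; no; ¬_)
open import Relation.Nullary.Decidable using (⌊_⌋; ¬?)
open import Relation.Binary.PropositionalEquality using (_≡_)

-- Sequences of positive integers are List ℕ / Vec ℕ n (values are the
-- actual positive integers, positions are 1-indexed as in the paper).

record IsParkingContent {n : ℕ} (b : Vec ℕ n) : Set where
  field
    positive   : ∀ (i : Fin n) → 1 ≤ lookup b i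
    increasing : ∀ (i j : Fin n) → toℕ i ≤ toℕ j → lookup b i ≤ lookup b j
    bounded    : ∀ (i : Fin n) → lookup b i ≤ suc (toℕ i)

allVecs : ∀ {A : Set} → List A → (m : ℕ) → List (Vec A m)
allVecs xs zero    = [] ∷ []
allVecs xs (suc m) = concatMap (λ x → map (x ∷_) (allVecs xs m)) xs

IsInjective : ∀ {n} → Vec (Fin n) n → Set
IsInjective {n} w = ∀ (i j : Fin n) → lookup w i ≡ lookup w j → i ≡ j

isInjective? : ∀ {n} (w : Vec (Fin n) n) → Dec (IsInjective w)
isInjective? {n} w =
  all? λ i → all? λ j → dec i j
  where
  dec : (i j : Fin n) → Dec (lookup w i ≡ lookup w j → i ≡ j)
  dec i j with lookup w i ≟ᶠ lookup w j | i ≟ᶠ j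
  ... | _      | yes e = yes (λ _ → e)
  ... | no ne  | no _  = yes (λ e → Relation.Nullary.contradiction e ne)
    where import Relation.Nullary
  ... | yes e  | no ne = no (λ f → ne (f e))


symmetricGroup : (n : ℕ) → List (Vec (Fin n) n)
symmetricGroup n = filter isInjective? (allVecs (allFin n) n)

piBW : ∀ {n} → Vec ℕ n → Vec (Fin n) n → List ℕ
piBW b w = toList (Data.Vec.map (lookup b) w)
  where import Data.Vec

excedFrom : ℕ → List ℕ → ℕ
excedFrom i []       = 0
excedFrom i (x ∷ xs) with i <? x
... | yes _ = suc (excedFrom (suc i) xs)
... | no  _ = excedFrom (suc i) xs

exced : List ℕ → ℕ
exced = excedFrom 1

desFrom : ℕ → List ℕ → ℕ
desFrom x []       = 0
desFrom x (y ∷ ys) with y <? x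
... | yes _ = suc (desFrom y ys)
... | no  _ = desFrom y ys

des : List ℕ → ℕ
des []       = 0
des (x ∷ xs) = desFrom x xs

-- Parking procedure.  nextFree fuel occ p = least q ≥ p with q ∉ occ
-- (fuel length occ + 1 always suffices: among p,…,p+|occ| some spot is free).

nextFree : ℕ → List ℕ → ℕ → ℕ
nextFree zero    occ p = p
nextFree (suc f) occ p with any? (p ≟_) occ
... | yes _ = nextFree f occ (suc p)
... | no  _ = p

parkFrom : List ℕ → List ℕ → List ℕ
parkFrom occ []       = []
parkFrom occ (x ∷ xs) =
  let s = nextFree (suc (length occ)) occ x in s ∷ parkFrom (s ∷ occ) xs

-- oc(π): the i-th entry is the spot σ(i) where car i parks.
oc : List ℕ → List ℕ
oc = parkFrom []

-- Coefficient of t^k in  Σ_{w ∈ S_n} t^{f(w)}.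

coeff : ∀ {n} → (Vec (Fin n) n → ℕ) → ℕ → ℕ
coeff {n} f k = length (filter (λ w → f w ≟ k) (symmetricGroup n))

excedPoly : ∀ {n} → Vec ℕ n → ℕ → ℕ
excedPoly b = coeff (λ w → exced (piBW b w))

desPoly : ∀ {n} → Vec ℕ n → ℕ → ℕ
desPoly b = coeff (λ w → des (oc (piBW b w)))

module Submission where

-- Let m be the last, and largest, entry of the parking content. Every permutation
-- of 0, …, n arises exactly once from a permutation q of 0, …, n - 1 and a slot
-- i ≤ n in each of two ways: insert n at position i, or put n at position i and
-- move the entry it displaces to the end.
--
-- Under the second construction only position i can change its exceedance status
-- (the displaced entry is at most m ≤ n + 1, so it does not exceed position
-- n + 1), and it gains an exceedance exactly when πᵢ ≤ i < m. With e the
-- exceedance number of π^{b,q}, the n + 1 slots thus give e + 1 exactly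
-- (m - 1) - e times and e otherwise.
--
-- Under the first construction all other cars prefer spots ≤ m, so the occupied
-- spots ≥ m always form an interval [m, t): the new car parks at t, and every
-- later car that would have parked at u ≥ m parks at u + 1 instead. The descent
-- at the insertion point is thereby replaced by "the next spot is below m".
-- Every descent of an outcome ends below m, and exactly m - 1 entries of the
-- outcome (a permutation of 1, …, n) are below m, so with d its descent number
-- the slots give d + 1 exactly (m - 1) - d times and d otherwise.
--
-- Hence both statistics obey the same recursion on multisets, and the theorem
-- follows by induction on n.

open import Defs
open import Data.Nat using (ℕ; zero; suc; _+_; _∸_; _≤_; _<_; s≤s; z<s; s<s; _≟_; _<?_; _≤?_)
open import Data.Nat.Properties
open import Data.Product using (∃; ∃₂; _×_; _,_; proj₁; proj₂)
open import Data.Sum using (_⊎_; inj₁; inj₂)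
open import Data.Fin using (Fin; toℕ; fromℕ<)
import Data.Fin.Properties as Fin
open import Data.List using (List; []; _∷_; _++_; _∷ʳ_; [_]; length; map; filter; concatMap; replicate; take; drop; applyUpTo; upTo; allFin; initLast; _∷ʳ′_)
open import Data.List.Properties using (map-cong; map-∘; map-id; map-++; map-replicate; map-applyUpTo; map-concatMap; concatMap-map; concatMap-cong; ++-identityʳ; ++-conicalʳ; ∷-injective; ∷-injectiveˡ; ∷-injectiveʳ; ∷ʳ-injective; length-++; length-map; length-take; length-upTo; length-applyUpTo; applyUpTo-∷ʳ; take++drop≡id; take-map; drop-map; filter-accept; filter-reject)
open import Data.List.Membership.Propositional using (_∈_; _∉_)
open import Data.List.Membership.Propositional.Properties using (∈-∃++; ∈-++⁺ˡ; ∈-map⁺; ∈-map⁻; ∈-concat⁺′; ∈-concat⁻′; ∈-filter⁺; ∈-filter⁻; ∈-allFin; ∈-upTo⁺; ∈-upTo⁻; ∈-applyUpTo⁺; ∈-applyUpTo⁻)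
open import Data.List.Membership.Propositional.Properties.WithK using (unique∧set⇒bag)
open import Data.List.Relation.Unary.All as All using (All; []; _∷_)
open import Data.List.Relation.Unary.All.Properties as All using (¬Any⇒All¬)
open import Data.List.Relation.Unary.Any using (here; there; any?)
open import Data.List.Relation.Unary.Linked using (Linked; []; [-]; _∷_)
open import Data.List.Relation.Unary.Unique.Propositional using (Unique; []; _∷_)
import Data.List.Relation.Unary.Unique.Propositional.Properties as Unique
open import Data.List.Relation.Binary.Disjoint.Propositional using (Disjoint)
open import Data.List.Relation.Binary.Subset.Propositional using (_⊆_)
open import Data.List.Relation.Binary.BagAndSetEquality using (∼bag⇒↭)
open import Data.List.Relation.Binary.Permutation.Propositional using (_↭_; refl; prep; swap; trans; ↭-refl; ↭-reflexive; ↭-sym; ↭-trans; ↭⇒↭ₛ; module PermutationReasoning)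
open import Data.List.Relation.Binary.Permutation.Propositional.Properties using (↭-empty-inv; map⁺; ++⁺; ++⁺ˡ; shift; shifts; drop-∷; ∈-resp-↭; All-resp-↭; ↭-length; filter-↭; ∷↭∷ʳ)
import Data.List.Relation.Binary.Permutation.Setoid.Properties as ↭ₛ
open import Data.Vec using (Vec; []; _∷_; lookup; toList)
import Data.Vec as V
open import Data.Vec.Properties using (lookup-map; length-toList)
open import Data.Vec.Membership.Propositional.Properties using (∈-lookup; ∈-toList⁺)
open import Function using (_∘_)
open import Function.Bundles using (_⇔_; mk⇔; module Equivalence)
open import Relation.Nullary using (Dec; yes; no; contradiction)
open import Relation.Binary.Definitions using (tri<; tri≈; tri>)
open import Relation.Binary.PropositionalEquality using (_≡_; _≢_; refl; sym; cong; cong₂; subst; subst₂; setoid; module ≡-Reasoning)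
  renaming (trans to ≡-trans)

open Equivalence using (to; from)

private
  variable
    A B : Set
    n N M s : ℕ
    xs ys : List A
    p q L : List ℕ
    ρ : List ℕ → List ℕ

⟦_⟧ : {P : Set} → Dec P → ℕ
⟦ yes _ ⟧ = 1
⟦ no _ ⟧ = 0

iverson-cong : {P Q : Set} (p : Dec P) (q : Dec Q) → P ⇔ Q → ⟦ p ⟧ ≡ ⟦ q ⟧
iverson-cong (yes _) (yes _) _ = refl
iverson-cong (no _) (no _) _ = refl
iverson-cong (yes P) (no ¬Q) P⇔Q = contradiction (to P⇔Q P) ¬Q
iverson-cong (no ¬P) (yes Q) P⇔Q = contradiction (from P⇔Q Q) ¬P

iverson-∸-suc : ∀ j x → ⟦ j <? x ⟧ + (x ∸ suc j) ≡ x ∸ j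
iverson-∸-suc j x with j <? x
... | yes j<x = sym (+-∸-assoc 1 j<x)
... | no j≮x = ≡-trans (m≤n⇒m∸n≡0 (m≤n⇒m≤1+n x≤j)) (sym (m≤n⇒m∸n≡0 x≤j))
  where x≤j = ≮⇒≥ j≮x

-- Lists

Unique-resp-↭ : xs ↭ ys → Unique xs → Unique ys
Unique-resp-↭ xs↭ys = ↭ₛ.Unique-resp-↭ (setoid _) (↭⇒↭ₛ xs↭ys)

concatMap⁺ : (f : A → List B) → xs ↭ ys → concatMap f xs ↭ concatMap f ys
concatMap⁺ f refl = refl
concatMap⁺ f (prep x p) = ++⁺ˡ (f x) (concatMap⁺ f p)
concatMap⁺ f (swap x y p) = ↭-trans (shifts (f x) (f y)) (++⁺ˡ (f y) (++⁺ˡ (f x) (concatMap⁺ f p)))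
concatMap⁺ f (trans p q) = ↭-trans (concatMap⁺ f p) (concatMap⁺ f q)

concatMap-↭-local : {f g : A → List B} → (∀ {x} → x ∈ xs → f x ↭ g x) →
                    concatMap f xs ↭ concatMap g xs
concatMap-↭-local {xs = []} _ = refl
concatMap-↭-local {xs = x ∷ xs} f↭g = ++⁺ (f↭g (here refl)) (concatMap-↭-local (f↭g ∘ there))

concatMap-unique : {f : A → List B} → Unique xs → (∀ {x} → x ∈ xs → Unique (f x)) →
                   (∀ {x x′ y} → x ∈ xs → x′ ∈ xs → y ∈ f x → y ∈ f x′ → x ≡ x′) →
                   Unique (concatMap f xs)
concatMap-unique {xs = []} _ _ _ = []
concatMap-unique {xs = x ∷ xs} {f = f} (x∉xs ∷ u) f-unique f-disjoint =
  Unique.++⁺ (f-unique (here refl))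
             (concatMap-unique u (f-unique ∘ there) (λ x∈ x′∈ → f-disjoint (there x∈) (there x′∈)))
             disjoint
  where
  disjoint : Disjoint (f x) (concatMap f xs)
  disjoint (y∈fx , y∈rest) with ∈-concat⁻′ (map f xs) y∈rest
  ... | vs , y∈vs , vs∈ with ∈-map⁻ f vs∈
  ... | x′ , x′∈xs , refl = All.lookup x∉xs x′∈xs (f-disjoint (here refl) (there x′∈xs) y∈fx y∈vs)

unique-⊆⇒↭-++ : Unique xs → xs ⊆ ys → ∃ λ zs → ys ↭ xs ++ zs
unique-⊆⇒↭-++ {xs = []} {ys} _ _ = ys , refl
unique-⊆⇒↭-++ {xs = x ∷ xs} (x∉xs ∷ u) xs⊆ys with ∈-∃++ (xs⊆ys (here refl))
... | ys₁ , ys₂ , refl =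
  let zs , ↭zs = unique-⊆⇒↭-++ u rest⊆ in zs , ↭-trans (shift x ys₁ ys₂) (prep x ↭zs)
  where
  rest⊆ : xs ⊆ ys₁ ++ ys₂
  rest⊆ y∈xs with ∈-resp-↭ (shift x ys₁ ys₂) (xs⊆ys (there y∈xs))
  ... | here refl = contradiction refl (All.lookup x∉xs y∈xs)
  ... | there y∈ = y∈

unique-⊆⇒length≤ : Unique xs → xs ⊆ ys → length xs ≤ length ys
unique-⊆⇒length≤ {xs = xs} u xs⊆ys =
  let _ , ys↭ = unique-⊆⇒↭-++ u xs⊆ys
  in subst (length xs ≤_) (sym (≡-trans (↭-length ys↭) (length-++ xs))) (m≤m+n _ _)

unique-⊆⇒↭ : Unique xs → xs ⊆ ys → length ys ≡ length xs → xs ↭ ys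
unique-⊆⇒↭ {xs = xs} u xs⊆ys len with unique-⊆⇒↭-++ u xs⊆ys
... | [] , ys↭ = ↭-sym (↭-trans ys↭ (↭-reflexive (++-identityʳ xs)))
... | _ ∷ _ , ys↭ =
  contradiction (≡-trans (sym len) (≡-trans (↭-length ys↭) (length-++ xs))) (m+1+n≢m _ ∘ sym)

length-filter-map : {P : ℕ → Set} (P? : ∀ v → Dec (P v)) (f : A → ℕ) (xs : List A) →
                    length (filter (P? ∘ f) xs) ≡ length (filter P? (map f xs))
length-filter-map P? f [] = refl
length-filter-map P? f (x ∷ xs) with P? (f x)
... | yes _ = cong suc (length-filter-map P? f xs)
... | no _ = length-filter-map P? f xs

applyUpTo-cong-< : ∀ {f g : ℕ → A} n → (∀ {i} → i < n → f i ≡ g i) → applyUpTo f n ≡ applyUpTo g n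
applyUpTo-cong-< zero _ = refl
applyUpTo-cong-< (suc n) f≡g = cong₂ _∷_ (f≡g z<s) (applyUpTo-cong-< n (f≡g ∘ s<s))

take-length-++ : ∀ (xs : List A) ys → take (length xs) (xs ++ ys) ≡ xs
take-length-++ [] ys = refl
take-length-++ (x ∷ xs) ys = cong (x ∷_) (take-length-++ xs ys)

drop-length-++ : ∀ (xs : List A) ys → drop (length xs) (xs ++ ys) ≡ ys
drop-length-++ [] ys = refl
drop-length-++ (x ∷ xs) ys = drop-length-++ xs ys

length-take-≤ : ∀ k (xs : List A) → k ≤ length xs → length (take k xs) ≡ k
length-take-≤ k xs k≤ = ≡-trans (length-take k xs) (m≤n⇒m⊓n≡m k≤)

∉-take : ∀ {x : A} k → x ∉ xs → x ∉ take k xs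
∉-take {xs = xs} k x∉xs x∈ = x∉xs (subst (_ ∈_) (take++drop≡id k xs) (∈-++⁺ˡ x∈))

first-split-unique : ∀ {x : A} xs₁ xs₂ ys₁ ys₂ → x ∉ xs₁ → x ∉ ys₁ →
                     xs₁ ++ x ∷ xs₂ ≡ ys₁ ++ x ∷ ys₂ → xs₁ ≡ ys₁ × xs₂ ≡ ys₂
first-split-unique [] _ [] _ _ _ e = refl , ∷-injectiveʳ e
first-split-unique [] _ (y ∷ _) _ _ x∉ e = contradiction (here (∷-injectiveˡ e)) x∉
first-split-unique (z ∷ _) _ [] _ x∉ _ e = contradiction (here (sym (∷-injectiveˡ e))) x∉
first-split-unique (z ∷ xs₁) xs₂ (y ∷ ys₁) ys₂ x∉ x∉′ e with ∷-injective e
... | refl , e′ =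
  let xs₁≡ys₁ , xs₂≡ys₂ = first-split-unique xs₁ xs₂ ys₁ ys₂ (x∉ ∘ there) (x∉′ ∘ there) e′
  in  cong (z ∷_) xs₁≡ys₁ , xs₂≡ys₂

-- Multisets of two consecutive values

levels : (a c s : ℕ) → List ℕ
levels a c s = replicate a s ++ replicate c (suc s)

Levels : (N M s : ℕ) → List ℕ → Set
Levels N M s L = ∃₂ λ a c → a + c ≡ N × c + s ≡ M × L ↭ levels a c s

spread : (N M s : ℕ) → List ℕ
spread N M s = levels (N ∸ (M ∸ s)) (M ∸ s) s

Levels⇒↭spread : Levels N M s L → L ↭ spread N M s
Levels⇒↭spread {s = s} (a , c , refl , refl , L↭) rewrite m+n∸n≡m c s | m+n∸n≡m a c = L↭

Levels-cong : ∀ {M′ s′ L′} → M ≡ M′ → s ≡ s′ → L ≡ L′ →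
              Levels N M s L → Levels N M′ s′ L′
Levels-cong refl refl refl lv = lv

map-suc-levels : ∀ a c s → map suc (levels a c s) ≡ levels a c (suc s)
map-suc-levels a c s = ≡-trans (map-++ suc (replicate a s) _)
                               (cong₂ _++_ (map-replicate suc a s) (map-replicate suc c (suc s)))

levels-cons : {Q : Set} (q : Dec Q) → Levels N M s L → Levels (suc N) (⟦ q ⟧ + M) s ((⟦ q ⟧ + s) ∷ L)
levels-cons {s = s} (yes _) (a , c , refl , refl , L↭) =
  a , suc c , +-suc a c , refl ,
  ↭-trans (prep (suc s) L↭) (↭-sym (shift (suc s) (replicate a s) (replicate c (suc s))))
levels-cons {s = s} (no _) (a , c , refl , refl , L↭) = suc a , c , refl , refl , prep s L↭

levels-extend : {P Q : Set} (p : Dec P) (q : Dec Q) → (P → Q) → Levels N M s L →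
                Levels (suc N) (⟦ q ⟧ + M) (⟦ p ⟧ + s) ((⟦ q ⟧ + s) ∷ map (⟦ p ⟧ +_) L)
levels-extend {s = s} (yes _) (yes _) _ (a , c , refl , refl , L↭) =
  suc a , c , refl , +-suc c s ,
  prep (suc s) (↭-trans (map⁺ suc L↭) (↭-reflexive (map-suc-levels a c s)))
levels-extend (yes P) (no ¬Q) P⇒Q _ = contradiction (P⇒Q P) ¬Q
levels-extend {L = L} (no _) q _ lv =
  subst (λ T → Levels _ _ _ (_ ∷ T)) (sym (map-id L)) (levels-cons q lv)

-- Permutations as lists

oneLine : ∀ {n k} → Vec (Fin n) k → List ℕ
oneLine w = toList (V.map toℕ w)

permutations : ℕ → List (List ℕ)
permutations n = map oneLine (symmetricGroup n)

oneLine-injective : ∀ {n k} {v w : Vec (Fin n) k} → oneLine v ≡ oneLine w → v ≡ w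
oneLine-injective {v = []} {[]} _ = refl
oneLine-injective {v = x ∷ v} {y ∷ w} e =
  cong₂ _∷_ (Fin.toℕ-injective (∷-injectiveˡ e)) (oneLine-injective (∷-injectiveʳ e))

oneLine-< : ∀ {n k} (w : Vec (Fin n) k) → All (_< n) (oneLine w)
oneLine-< [] = []
oneLine-< (x ∷ w) = Fin.toℕ<n x ∷ oneLine-< w

toList-unique⁺ : ∀ {k} {v : Vec A k} → (∀ i j → lookup v i ≡ lookup v j → i ≡ j) → Unique (toList v)
toList-unique⁺ {v = []} _ = []
toList-unique⁺ {v = x ∷ v} inj =
  fresh v (λ i → Fin.0≢1+n ∘ inj Fin.zero (Fin.suc i)) ∷
  toList-unique⁺ (λ i j → Fin.suc-injective ∘ inj (Fin.suc i) (Fin.suc j))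
  where
  fresh : ∀ {k} (u : Vec _ k) → (∀ i → x ≢ lookup u i) → All (x ≢_) (toList u)
  fresh [] _ = []
  fresh (y ∷ u) x≢ = x≢ Fin.zero ∷ fresh u (x≢ ∘ Fin.suc)

toList-unique⁻ : ∀ {k} {v : Vec A k} → Unique (toList v) → ∀ i j → lookup v i ≡ lookup v j → i ≡ j
toList-unique⁻ {v = x ∷ v} _ Fin.zero Fin.zero _ = refl
toList-unique⁻ {v = x ∷ v} (x∉ ∷ _) Fin.zero (Fin.suc j) e =
  contradiction e (All.lookup x∉ (∈-toList⁺ (∈-lookup j v)))
toList-unique⁻ {v = x ∷ v} (x∉ ∷ _) (Fin.suc i) Fin.zero e =
  contradiction (sym e) (All.lookup x∉ (∈-toList⁺ (∈-lookup i v)))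
toList-unique⁻ {v = x ∷ v} (_ ∷ u) (Fin.suc i) (Fin.suc j) e = cong Fin.suc (toList-unique⁻ u i j e)

isInjective⇒unique : ∀ {n} {w : Vec (Fin n) n} → IsInjective w → Unique (oneLine w)
isInjective⇒unique {w = w} inj = toList-unique⁺ λ i j e →
  inj i j (Fin.toℕ-injective (≡-trans (sym (lookup-map i toℕ w)) (≡-trans e (lookup-map j toℕ w))))

unique⇒isInjective : ∀ {n} {w : Vec (Fin n) n} → Unique (oneLine w) → IsInjective w
unique⇒isInjective {w = w} u i j e =
  toList-unique⁻ u i j (≡-trans (lookup-map i toℕ w) (≡-trans (cong toℕ e) (sym (lookup-map j toℕ w))))

allVecs-complete : ∀ {n k} (w : Vec (Fin n) k) → w ∈ allVecs (allFin n) k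
allVecs-complete [] = here refl
allVecs-complete (x ∷ w) = ∈-concat⁺′ (∈-map⁺ (x ∷_) (allVecs-complete w)) (∈-map⁺ _ (∈-allFin x))

allVecs-unique : ∀ {xs : List A} k → Unique xs → Unique (allVecs xs k)
allVecs-unique zero _ = [] ∷ []
allVecs-unique (suc k) u =
  concatMap-unique u (λ _ → Unique.map⁺ ∷-injectiveʳ-vec (allVecs-unique k u)) (λ _ _ → head≡)
  where
  ∷-injectiveʳ-vec : ∀ {x : A} {v w : Vec A k} → x V.∷ v ≡ x V.∷ w → v ≡ w
  ∷-injectiveʳ-vec refl = refl
  head≡ : ∀ {x x′ : A} {ws : List (Vec A k)} {v} →
          v ∈ map (x V.∷_) ws → v ∈ map (x′ V.∷_) ws → x ≡ x′
  head≡ v∈ v∈′ with ∈-map⁻ _ v∈ | ∈-map⁻ _ v∈′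
  ... | _ , _ , refl | _ , _ , refl = refl

permutations-unique : ∀ n → Unique (permutations n)
permutations-unique n =
  Unique.map⁺ oneLine-injective (Unique.filter⁺ isInjective? (allVecs-unique n (Unique.allFin⁺ n)))

upTo-suc-↭ : ∀ n → upTo (suc n) ↭ n ∷ upTo n
upTo-suc-↭ n = ↭-trans (↭-reflexive (sym (applyUpTo-∷ʳ (λ i → i) n))) (↭-sym (∷↭∷ʳ n (upTo n)))

↭upTo⇒< : p ↭ upTo n → All (_< n) p
↭upTo⇒< p↭ = All-resp-↭ (↭-sym p↭) (All.tabulate ∈-upTo⁻)

↭upTo⇒length : p ↭ upTo n → length p ≡ n
↭upTo⇒length {n = n} p↭ = ≡-trans (↭-length p↭) (length-upTo n)

∈-permutations⁻ : p ∈ permutations n → p ↭ upTo n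
∈-permutations⁻ {n = n} p∈ with ∈-map⁻ oneLine p∈
... | w , w∈ , refl =
  unique-⊆⇒↭ (isInjective⇒unique (proj₂ (∈-filter⁻ isInjective? {xs = allVecs (allFin n) n} w∈)))
             (∈-upTo⁺ ∘ All.lookup (oneLine-< w))
             (≡-trans (length-upTo n) (sym (length-toList (V.map toℕ w))))

toFinVec : (p : List ℕ) → All (_< n) p → Vec (Fin n) (length p)
toFinVec [] [] = []
toFinVec (x ∷ p) (x<n ∷ p<n) = fromℕ< x<n ∷ toFinVec p p<n

oneLine-toFinVec : (p : List ℕ) (p<n : All (_< n) p) → oneLine (toFinVec p p<n) ≡ p
oneLine-toFinVec [] [] = refl
oneLine-toFinVec (x ∷ p) (x<n ∷ p<n) = cong₂ _∷_ (Fin.toℕ-fromℕ< x<n) (oneLine-toFinVec p p<n)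

∈-permutations⁺ : p ↭ upTo n → p ∈ permutations n
∈-permutations⁺ {p} {n} p↭ =
  subst (_∈ permutations n) (oneLine-toFinVec p p<n) (oneLine∈ (toFinVec p p<n) (↭upTo⇒length p↭) unique)
  where
  p<n = ↭upTo⇒< p↭
  unique : Unique (oneLine (toFinVec p p<n))
  unique = subst Unique (sym (oneLine-toFinVec p p<n)) (Unique-resp-↭ (↭-sym p↭) (Unique.upTo⁺ n))
  oneLine∈ : ∀ {k} (w : Vec (Fin n) k) → k ≡ n → Unique (oneLine w) → oneLine w ∈ permutations n
  oneLine∈ w refl u = ∈-map⁺ oneLine (∈-filter⁺ isInjective? (allVecs-complete w) (unique⇒isInjective u))

rotate : List A → List A
rotate [] = []
rotate (y ∷ ys) = ys ∷ʳ y

record IsReordering (ρ : List ℕ → List ℕ) : Set where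
  field
    ↭-id       : ∀ s → ρ s ↭ s
    injective  : ∀ {s t} → ρ s ≡ ρ t → s ≡ t
    surjective : ∀ s → ∃ λ t → ρ t ≡ s
    natural    : ∀ f s → map f (ρ s) ≡ ρ (map f s)

id-isReordering : IsReordering (λ s → s)
id-isReordering = record
  { ↭-id = λ _ → ↭-refl ; injective = λ e → e ; surjective = λ s → s , refl ; natural = λ _ _ → refl }

rotate-isReordering : IsReordering rotate
rotate-isReordering = record
  { ↭-id = rotate-↭ ; injective = rotate-injective ; surjective = rotate-surjective ; natural = map-rotate }
  where
  rotate-↭ : ∀ s → rotate s ↭ s
  rotate-↭ [] = ↭-refl
  rotate-↭ (y ∷ ys) = ↭-sym (∷↭∷ʳ y ys)

  rotate-injective : ∀ {s t} → rotate s ≡ rotate t → s ≡ t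
  rotate-injective {[]} {[]} _ = refl
  rotate-injective {[]} {z ∷ zs} e with () ← ++-conicalʳ zs [ z ] (sym e)
  rotate-injective {y ∷ ys} {[]} e with () ← ++-conicalʳ ys [ y ] e
  rotate-injective {y ∷ ys} {z ∷ zs} e with refl , refl ← ∷ʳ-injective ys zs e = refl

  rotate-surjective : ∀ s → ∃ λ t → rotate t ≡ s
  rotate-surjective s with initLast s
  ... | [] = [] , refl
  ... | xs ∷ʳ′ x = x ∷ xs , refl

  map-rotate : ∀ f s → map f (rotate s) ≡ rotate (map f s)
  map-rotate f [] = refl
  map-rotate f (y ∷ ys) = map-++ f ys [ y ]

rearrangeAt : (List ℕ → List ℕ) → ℕ → ℕ → List ℕ → List ℕ
rearrangeAt ρ i x ys = take i ys ++ x ∷ ρ (drop i ys)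

insertAt displaceAt : ℕ → ℕ → List ℕ → List ℕ
insertAt = rearrangeAt (λ s → s)
displaceAt = rearrangeAt rotate

insertions : (List ℕ → List ℕ) → ℕ → List (List ℕ)
insertions ρ n = concatMap (λ q → applyUpTo (λ i → rearrangeAt ρ i n q) (suc n)) (permutations n)

module _ (isReordering : IsReordering ρ) where
  open IsReordering isReordering

  rearrangeAt-↭ : ∀ i x ys → rearrangeAt ρ i x ys ↭ x ∷ ys
  rearrangeAt-↭ i x ys = begin
    take i ys ++ x ∷ ρ (drop i ys) ↭⟨ shift x (take i ys) _ ⟩
    x ∷ take i ys ++ ρ (drop i ys) ↭⟨ prep x (++⁺ˡ (take i ys) (↭-id (drop i ys))) ⟩
    x ∷ take i ys ++ drop i ys     ≡⟨ cong (x ∷_) (take++drop≡id i ys) ⟩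
    x ∷ ys                         ∎
    where open PermutationReasoning

  map-rearrangeAt : ∀ (f : ℕ → ℕ) i x ys → map f (rearrangeAt ρ i x ys) ≡ rearrangeAt ρ i (f x) (map f ys)
  map-rearrangeAt f i x ys = begin
    map f (take i ys ++ x ∷ ρ (drop i ys))
      ≡⟨ map-++ f (take i ys) _ ⟩
    map f (take i ys) ++ f x ∷ map f (ρ (drop i ys))
      ≡⟨ cong₂ (λ l r → l ++ f x ∷ r) (sym (take-map i ys))
               (≡-trans (natural f _) (cong ρ (sym (drop-map i ys)))) ⟩
    take i (map f ys) ++ f x ∷ ρ (drop i (map f ys)) ∎
    where open ≡-Reasoning

  rearrangeAt-injective : ∀ {i j x ys zs} → x ∉ ys → x ∉ zs → i ≤ length ys → j ≤ length zs →
                          rearrangeAt ρ i x ys ≡ rearrangeAt ρ j x zs → i ≡ j × ys ≡ zs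
  rearrangeAt-injective {i} {j} {x} {ys} {zs} x∉ys x∉zs i≤ j≤ e
    with take≡ , ρdrop≡ ← first-split-unique (take i ys) _ (take j zs) _
                                             (∉-take i x∉ys) (∉-take j x∉zs) e =
    ≡-trans (sym (length-take-≤ i ys i≤)) (≡-trans (cong length take≡) (length-take-≤ j zs j≤)) ,
    (begin
      ys                        ≡⟨ take++drop≡id i ys ⟨
      take i ys ++ drop i ys    ≡⟨ cong₂ _++_ take≡ (injective ρdrop≡) ⟩
      take j zs ++ drop j zs    ≡⟨ take++drop≡id j zs ⟩
      zs                        ∎)
    where open ≡-Reasoning

  rearrangeAt-surjective : ∀ x xs ys → ∃₂ λ i q → i ≤ length q × rearrangeAt ρ i x q ≡ xs ++ x ∷ ys
  rearrangeAt-surjective x xs ys =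
    let t , ρt≡ys = surjective ys
    in length xs , xs ++ t ,
       subst (length xs ≤_) (sym (length-++ xs)) (m≤m+n _ _) ,
       cong₂ (λ l r → l ++ x ∷ r) (take-length-++ xs t) (≡-trans (cong ρ (drop-length-++ xs t)) ρt≡ys)

  rearrangeAt-↭upTo : ∀ {i} → q ↭ upTo n → rearrangeAt ρ i n q ↭ upTo (suc n)
  rearrangeAt-↭upTo {q} {n} {i} q↭ =
    ↭-trans (rearrangeAt-↭ i n q) (↭-trans (prep n q↭) (↭-sym (upTo-suc-↭ n)))

  rearrangeAt-injective-↭upTo : ∀ {q r i j} → q ↭ upTo n → r ↭ upTo n → i < suc n → j < suc n →
                                rearrangeAt ρ i n q ≡ rearrangeAt ρ j n r → i ≡ j × q ≡ r
  rearrangeAt-injective-↭upTo q↭ r↭ (s≤s i≤n) (s≤s j≤n) =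
    rearrangeAt-injective (n∉ q↭) (n∉ r↭)
      (subst (_ ≤_) (sym (↭upTo⇒length q↭)) i≤n) (subst (_ ≤_) (sym (↭upTo⇒length r↭)) j≤n)
    where
    n∉ : p ↭ upTo n → n ∉ p
    n∉ p↭ n∈p = <-irrefl refl (All.lookup (↭upTo⇒< p↭) n∈p)

  ∈-insertions⁻ : p ∈ insertions ρ n →
                  ∃₂ λ q i → q ↭ upTo n × i < suc n × p ≡ rearrangeAt ρ i n q
  ∈-insertions⁻ {n = n} p∈ with ∈-concat⁻′ (map _ (permutations n)) p∈
  ... | vs , p∈vs , vs∈ with ∈-map⁻ _ vs∈
  ... | q , q∈ , refl with ∈-applyUpTo⁻ (λ i → rearrangeAt ρ i n q) p∈vs
  ... | i , i< , p≡ = q , i , ∈-permutations⁻ q∈ , i< , p≡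

  ∈-insertions⁺ : p ↭ upTo (suc n) → p ∈ insertions ρ n
  ∈-insertions⁺ {p} {n} p↭ with ∈-∃++ (∈-resp-↭ (↭-sym p↭) (∈-upTo⁺ (n<1+n n)))
  ... | xs , ys , refl with rearrangeAt-surjective n xs ys
  ... | i , q , i≤ , q↦p = subst (_∈ insertions ρ n) q↦p
    (∈-concat⁺′ (∈-applyUpTo⁺ (λ j → rearrangeAt ρ j n q) (s≤s (subst (i ≤_) (↭upTo⇒length q↭) i≤)))
                (∈-map⁺ _ (∈-permutations⁺ q↭)))
    where
    q↭ : q ↭ upTo n
    q↭ = drop-∷ (↭-trans (↭-sym (rearrangeAt-↭ i n q))
                        (↭-trans (subst (_↭ _) (sym q↦p) p↭) (upTo-suc-↭ n)))

  insertions-unique : ∀ n → Unique (insertions ρ n)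
  insertions-unique n = concatMap-unique (permutations-unique n)
    (λ q∈ → let q↭ = ∈-permutations⁻ q∈ in Unique.applyUpTo⁺₁ _ (suc n) λ i<j j< e →
      <-irrefl (proj₁ (rearrangeAt-injective-↭upTo q↭ q↭ (<-trans i<j j<) j< e)) i<j)
    (λ q∈ r∈ p∈ p∈′ → disjoint (∈-permutations⁻ q∈) (∈-permutations⁻ r∈)
      (∈-applyUpTo⁻ (λ i → rearrangeAt ρ i n _) p∈)
      (∈-applyUpTo⁻ (λ i → rearrangeAt ρ i n _) p∈′))
    where
    disjoint : ∀ {q r p} → q ↭ upTo n → r ↭ upTo n →
               ∃ (λ i → i < suc n × p ≡ rearrangeAt ρ i n q) →
               ∃ (λ j → j < suc n × p ≡ rearrangeAt ρ j n r) → q ≡ r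
    disjoint q↭ r↭ (i , i< , refl) (j , j< , e) = proj₂ (rearrangeAt-injective-↭upTo q↭ r↭ i< j< e)

  permutations-suc-↭ : ∀ n → permutations (suc n) ↭ insertions ρ n
  permutations-suc-↭ n = ∼bag⇒↭ (unique∧set⇒bag (permutations-unique (suc n)) (insertions-unique n)
    (mk⇔ (∈-insertions⁺ ∘ ∈-permutations⁻)
         (λ p∈ → let q , i , q↭ , _ , p≡ = ∈-insertions⁻ p∈
                 in ∈-permutations⁺ (subst (_↭ _) (sym p≡) (rearrangeAt-↭upTo q↭)))))

  map-permutations-suc :
    (f : List ℕ → ℕ) (S : List ℕ → List ℕ) →
    (∀ {q} → q ↭ upTo n → applyUpTo (λ i → f (rearrangeAt ρ i n q)) (suc n) ↭ S q) →
    map f (permutations (suc n)) ↭ concatMap S (permutations n)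
  map-permutations-suc {n} f S slots = begin
    map f (permutations (suc n))
      ↭⟨ map⁺ f (permutations-suc-↭ n) ⟩
    map f (insertions ρ n)
      ≡⟨ map-concatMap f _ (permutations n) ⟩
    concatMap (λ q → map f (applyUpTo (λ i → rearrangeAt ρ i n q) (suc n))) (permutations n)
      ≡⟨ concatMap-cong (λ q → map-applyUpTo (λ i → rearrangeAt ρ i n q) f (suc n)) (permutations n) ⟩
    concatMap (λ q → applyUpTo (λ i → f (rearrangeAt ρ i n q)) (suc n)) (permutations n)
      ↭⟨ concatMap-↭-local (slots ∘ ∈-permutations⁻) ⟩
    concatMap S (permutations n) ∎
    where open PermutationReasoning

-- Exceedances

excedFrom-∷ : ∀ j x xs → excedFrom j (x ∷ xs) ≡ ⟦ j <? x ⟧ + excedFrom (suc j) xs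
excedFrom-∷ j x xs with j <? x
... | yes _ = refl
... | no _ = refl

excedFrom-∷ʳ : ∀ j xs y → y ≤ j + length xs → excedFrom j (xs ∷ʳ y) ≡ excedFrom j xs
excedFrom-∷ʳ j [] y y≤j with j <? y
... | yes j<y = contradiction (subst (y ≤_) (+-identityʳ j) y≤j) (<⇒≱ j<y)
... | no _ = refl
excedFrom-∷ʳ j (x ∷ xs) y y≤ with j <? x
... | yes _ = cong suc (excedFrom-∷ʳ (suc j) xs y (subst (y ≤_) (+-suc j _) y≤))
... | no _ = excedFrom-∷ʳ (suc j) xs y (subst (y ≤_) (+-suc j _) y≤)

-- Moving x to index i of ys (position j + i) and the entry yᵢ found there to the
-- end adds ⟦ yᵢ ≤ j + i < x ⟧ exceedances.
displaceAt-excedFrom-levels : ∀ j x ys → All (_≤ x) ys → x ≤ j + length ys →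
  Levels (suc (length ys)) (x ∸ j) (excedFrom j ys)
         (applyUpTo (λ i → excedFrom j (displaceAt i x ys)) (suc (length ys)))
displaceAt-excedFrom-levels j x [] [] x≤j =
  1 , 0 , refl , sym (m≤n⇒m∸n≡0 (subst (x ≤_) (+-identityʳ j) x≤j)) ,
  ↭-reflexive (cong [_] (excedFrom-∷ʳ j [] x x≤j))
displaceAt-excedFrom-levels j x (y ∷ ys) (y≤x ∷ ys≤x) x≤ =
  Levels-cong (iverson-∸-suc j x) (sym (excedFrom-∷ j y ys)) (sym slots≡)
    (levels-extend (j <? y) (j <? x) (λ j<y → <-≤-trans j<y y≤x)
      (displaceAt-excedFrom-levels (suc j) x ys ys≤x x≤′))
  where
  x≤′ : x ≤ suc j + length ys
  x≤′ = subst (x ≤_) (+-suc j (length ys)) x≤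
  slots≡ : applyUpTo (λ i → excedFrom j (displaceAt i x (y ∷ ys))) (suc (suc (length ys))) ≡
           (⟦ j <? x ⟧ + excedFrom (suc j) ys) ∷
           map (⟦ j <? y ⟧ +_) (applyUpTo (λ i → excedFrom (suc j) (displaceAt i x ys)) (suc (length ys)))
  slots≡ = cong₂ _∷_
    (≡-trans (excedFrom-∷ j x (ys ∷ʳ y))
             (cong (⟦ j <? x ⟧ +_) (excedFrom-∷ʳ (suc j) ys y (≤-trans y≤x x≤′))))
    (≡-trans (applyUpTo-cong-< (suc (length ys)) (λ {i} _ → excedFrom-∷ j y (displaceAt i x ys)))
             (sym (map-applyUpTo (λ i → excedFrom (suc j) (displaceAt i x ys)) (⟦ j <? y ⟧ +_) _)))

-- Parking

spot : List ℕ → ℕ → ℕ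
spot occ x = nextFree (suc (length occ)) occ x

occupied : List ℕ → List ℕ → List ℕ
occupied occ [] = occ
occupied occ (x ∷ xs) = occupied (spot occ x ∷ occ) xs

record LeastFree (occ : List ℕ) (x s : ℕ) : Set where
  constructor leastFree
  field
    x≤s    : x ≤ s
    free   : s ∉ occ
    filled : ∀ {u} → x ≤ u → u < s → u ∈ occ

leastFree-unique : ∀ {occ x s s′} → LeastFree occ x s → LeastFree occ x s′ → s ≡ s′
leastFree-unique {s = s} {s′} (leastFree x≤s s∉ filled) (leastFree x≤s′ s′∉ filled′) with <-cmp s s′
... | tri< s<s′ _ _ = contradiction (filled′ x≤s s<s′) s∉
... | tri≈ _ s≡s′ _ = s≡s′
... | tri> _ _ s′<s = contradiction (filled x≤s′ s′<s) s′∉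

leastFree-resp-↭ : ∀ {occ occ′ x s} → occ ↭ occ′ → LeastFree occ x s → LeastFree occ′ x s
leastFree-resp-↭ occ↭ (leastFree x≤s s∉ filled) =
  leastFree x≤s (s∉ ∘ ∈-resp-↭ (↭-sym occ↭)) (λ x≤u u<s → ∈-resp-↭ occ↭ (filled x≤u u<s))

nextFree-≥ : ∀ f occ x → x ≤ nextFree f occ x
nextFree-≥ zero occ x = ≤-refl
nextFree-≥ (suc f) occ x with any? (x ≟_) occ
... | yes _ = ≤-trans (n≤1+n x) (nextFree-≥ f occ (suc x))
... | no _ = ≤-refl

nextFree-filled : ∀ f occ x {u} → x ≤ u → u < nextFree f occ x → u ∈ occ
nextFree-filled zero occ x x≤u u< = contradiction u< (≤⇒≯ x≤u)
nextFree-filled (suc f) occ x {u} x≤u u< with any? (x ≟_) occ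
... | no _ = contradiction u< (≤⇒≯ x≤u)
... | yes x∈ with x ≟ u
...   | yes refl = x∈
...   | no x≢u = nextFree-filled f occ (suc x) (≤∧≢⇒< x≤u x≢u) u<

nextFree-free : ∀ f occ x → nextFree f occ x ∉ occ ⊎ nextFree f occ x ≡ x + f
nextFree-free zero occ x = inj₂ (sym (+-identityʳ x))
nextFree-free (suc f) occ x with any? (x ≟_) occ
... | no x∉ = inj₁ x∉
... | yes _ with nextFree-free f occ (suc x)
...   | inj₁ s∉ = inj₁ s∉
...   | inj₂ s≡ = inj₂ (≡-trans s≡ (sym (+-suc x f)))

-- The fuel suffices: the |occ| + 1 spots x, …, x + |occ| cannot all be occupied.
spot-leastFree : ∀ {occ} x → Unique occ → LeastFree occ x (spot occ x)
spot-leastFree {occ} x u = leastFree (nextFree-≥ _ occ x) free (nextFree-filled _ occ x)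
  where
  free : spot occ x ∉ occ
  free with nextFree-free (suc (length occ)) occ x
  ... | inj₁ s∉ = s∉
  ... | inj₂ s≡ = λ _ → 1+n≰n (subst (_≤ length occ) (length-applyUpTo (x +_) _)
                                     (unique-⊆⇒length≤ range-unique range⊆occ))
    where
    range-unique : Unique (applyUpTo (x +_) (suc (length occ)))
    range-unique = Unique.applyUpTo⁺₁ _ _ λ i<j _ e → <-irrefl (+-cancelˡ-≡ x _ _ e) i<j
    range⊆occ : applyUpTo (x +_) (suc (length occ)) ⊆ occ
    range⊆occ u∈ with ∈-applyUpTo⁻ (x +_) u∈
    ... | i , i< , refl = nextFree-filled _ occ x (m≤m+n x i) (subst (x + i <_) (sym s≡) (+-monoʳ-< x i<))

spot∷-unique : ∀ {occ} x → Unique occ → Unique (spot occ x ∷ occ)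
spot∷-unique {occ} x u = ¬Any⇒All¬ occ (LeastFree.free (spot-leastFree x u)) ∷ u

parkFrom-++ : ∀ occ xs ys → parkFrom occ (xs ++ ys) ≡ parkFrom occ xs ++ parkFrom (occupied occ xs) ys
parkFrom-++ occ [] ys = refl
parkFrom-++ occ (x ∷ xs) ys = cong (spot occ x ∷_) (parkFrom-++ (spot occ x ∷ occ) xs ys)

oc-take-drop : ∀ i π → oc (take i π) ++ parkFrom (occupied [] (take i π)) (drop i π) ≡ oc π
oc-take-drop i π = ≡-trans (sym (parkFrom-++ [] (take i π) (drop i π))) (cong oc (take++drop≡id i π))

length-parkFrom : ∀ occ xs → length (parkFrom occ xs) ≡ length xs
length-parkFrom occ [] = refl
length-parkFrom occ (x ∷ xs) = cong suc (length-parkFrom (spot occ x ∷ occ) xs)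

parkFrom-≥ : ∀ {k} occ {xs} → All (k ≤_) xs → All (k ≤_) (parkFrom occ xs)
parkFrom-≥ occ [] = []
parkFrom-≥ occ {x ∷ _} (k≤x ∷ k≤xs) =
  ≤-trans k≤x (nextFree-≥ _ occ x) ∷ parkFrom-≥ (spot occ x ∷ occ) k≤xs

occupied-↭ : ∀ occ xs → occupied occ xs ↭ parkFrom occ xs ++ occ
occupied-↭ occ [] = ↭-refl
occupied-↭ occ (x ∷ xs) =
  ↭-trans (occupied-↭ (spot occ x ∷ occ) xs) (shift (spot occ x) (parkFrom (spot occ x ∷ occ) xs) occ)

occupied-unique : ∀ {occ} xs → Unique occ → Unique (occupied occ xs)
occupied-unique [] u = u
occupied-unique (x ∷ xs) u = occupied-unique xs (spot∷-unique x u)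

oc-unique : ∀ xs → Unique (oc xs)
oc-unique xs =
  subst Unique (++-identityʳ (oc xs)) (Unique-resp-↭ (occupied-↭ [] xs) (occupied-unique xs []))

occupied-∈⁺ : ∀ {u} occ xs → u ∈ parkFrom occ xs → u ∈ occupied occ xs
occupied-∈⁺ occ xs u∈ = ∈-resp-↭ (↭-sym (occupied-↭ occ xs)) (∈-++⁺ˡ u∈)

occupied-∈⁻ : ∀ {u} xs → u ∈ occupied [] xs → u ∈ oc xs
occupied-∈⁻ xs u∈ = subst (_ ∈_) (++-identityʳ (oc xs)) (∈-resp-↭ (occupied-↭ [] xs) u∈)

-- Descents

desFrom-∷ : ∀ x y ys → desFrom x (y ∷ ys) ≡ ⟦ y <? x ⟧ + desFrom y ys
desFrom-∷ x y ys with y <? x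
... | yes _ = refl
... | no _ = refl

desFrom-++-top : ∀ {t} a ys zs → All (_< t) (a ∷ ys) →
                 desFrom a (ys ++ t ∷ zs) ≡ desFrom a ys + desFrom t zs
desFrom-++-top {t} a [] zs (a<t ∷ []) with t <? a
... | yes t<a = contradiction t<a (<-asym a<t)
... | no _ = refl
desFrom-++-top a (b ∷ ys) zs (_ ∷ b<t ∷ ys<t) with b <? a
... | yes _ = cong suc (desFrom-++-top b ys zs (b<t ∷ ys<t))
... | no _ = desFrom-++-top b ys zs (b<t ∷ ys<t)

des-++-top : ∀ {t} ys zs → All (_< t) ys → des (ys ++ t ∷ zs) ≡ des ys + desFrom t zs
des-++-top [] zs _ = refl
des-++-top (a ∷ ys) zs ys<t = desFrom-++-top a ys zs ys<t

countBelow : ℕ → List ℕ → ℕ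
countBelow m σ = length (filter (_<? m) σ)

countBelow-∷ : ∀ m y ys → countBelow m (y ∷ ys) ≡ ⟦ y <? m ⟧ + countBelow m ys
countBelow-∷ m y ys with y <? m
... | yes y<m = cong length (filter-accept (_<? m) y<m)
... | no y≮m = cong length (filter-reject (_<? m) y≮m)

countBelow-↭ : ∀ m {σ σ′} → σ ↭ σ′ → countBelow m σ ≡ countBelow m σ′
countBelow-↭ m σ↭ = ↭-length (filter-↭ (_<? m) σ↭)

countBelow-range : ∀ m k n → m ≤ k + n → countBelow m (applyUpTo (k +_) n) ≡ m ∸ k
countBelow-range m k zero m≤k = sym (m≤n⇒m∸n≡0 (subst (m ≤_) (+-identityʳ k) m≤k))
countBelow-range m k (suc n) m≤ = begin
  countBelow m (k + 0 ∷ applyUpTo (λ i → k + suc i) n)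
    ≡⟨ countBelow-∷ m (k + 0) _ ⟩
  ⟦ k + 0 <? m ⟧ + countBelow m (applyUpTo (λ i → k + suc i) n)
    ≡⟨ cong₂ (λ v l → ⟦ v <? m ⟧ + countBelow m l)
             (+-identityʳ k) (applyUpTo-cong-< n (λ {i} _ → +-suc k i)) ⟩
  ⟦ k <? m ⟧ + countBelow m (applyUpTo (suc k +_) n)
    ≡⟨ cong (⟦ k <? m ⟧ +_) (countBelow-range m (suc k) n (subst (m ≤_) (+-suc k n) m≤)) ⟩
  ⟦ k <? m ⟧ + (m ∸ suc k)
    ≡⟨ iverson-∸-suc k m ⟩
  m ∸ k ∎
  where open ≡-Reasoning

-- Adding a car that prefers m to cars that prefer spots ≤ m

module InsertMax (m : ℕ) where

  record IsBlock (occ : List ℕ) (t : ℕ) : Set where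
    field
      m≤t    : m ≤ t
      <t     : All (_< t) occ
      filled : ∀ {u} → m ≤ u → u < t → u ∈ occ

  open IsBlock

  block-[] : IsBlock [] m
  block-[] = record { m≤t = ≤-refl ; <t = [] ; filled = λ m≤u u<m → contradiction u<m (≤⇒≯ m≤u) }

  block-below : ∀ {occ t s} → IsBlock occ t → s < m → IsBlock (s ∷ occ) t
  block-below blk s<m = record
    { m≤t = m≤t blk
    ; <t = <-≤-trans s<m (m≤t blk) ∷ <t blk
    ; filled = λ m≤u u<t → there (filled blk m≤u u<t)
    }

  block-top : ∀ {occ t} → IsBlock occ t → IsBlock (t ∷ occ) (suc t)
  block-top {t = t} blk = record
    { m≤t = m≤n⇒m≤1+n (m≤t blk) ; <t = n<1+n t ∷ All.map m<n⇒m<1+n (<t blk) ; filled = filled′ }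
    where
    filled′ : ∀ {u} → m ≤ u → u < suc t → u ∈ t ∷ _
    filled′ {u} m≤u u<1+t with u ≟ t
    ... | yes refl = here refl
    ... | no u≢t = there (filled blk m≤u (≤∧≢⇒< (≤-pred u<1+t) u≢t))

  spot-≥m : ∀ {occ t x} → Unique occ → IsBlock occ t → x ≤ m → m ≤ spot occ x → spot occ x ≡ t
  spot-≥m {occ} {t} {x} u blk x≤m m≤s = leastFree-unique (spot-leastFree x u)
    (leastFree (≤-trans x≤m (m≤t blk)) (λ t∈ → <-irrefl refl (All.lookup (<t blk) t∈)) filled′)
    where
    filled′ : ∀ {v} → x ≤ v → v < t → v ∈ occ
    filled′ {v} x≤v v<t with v <? m
    ... | yes v<m = LeastFree.filled (spot-leastFree x u) x≤v (<-≤-trans v<m m≤s)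
    ... | no v≮m = filled blk (≮⇒≥ v≮m) v<t

  spot-m : ∀ {occ t} → Unique occ → IsBlock occ t → spot occ m ≡ t
  spot-m u blk = spot-≥m u blk ≤-refl (LeastFree.x≤s (spot-leastFree m u))

  block-step : ∀ {occ t x} → Unique occ → IsBlock occ t → x ≤ m →
               spot occ x < m × IsBlock (spot occ x ∷ occ) t ⊎
               spot occ x ≡ t × IsBlock (spot occ x ∷ occ) (suc t)
  block-step {occ} {t} {x} u blk x≤m with spot occ x <? m
  ... | yes s<m = inj₁ (s<m , block-below blk s<m)
  ... | no s≮m with spot-≥m u blk x≤m (≮⇒≥ s≮m)
  ...   | s≡t rewrite s≡t = inj₂ (refl , block-top blk)

  block-occupied : ∀ {occ t} xs → Unique occ → IsBlock occ t → All (_≤ m) xs →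
                   ∃ (IsBlock (occupied occ xs))
  block-occupied [] u blk [] = _ , blk
  block-occupied (x ∷ xs) u blk (x≤m ∷ xs≤m) with block-step u blk x≤m
  ... | inj₁ (_ , blk′) = block-occupied xs (spot∷-unique x u) blk′ xs≤m
  ... | inj₂ (_ , blk′) = block-occupied xs (spot∷-unique x u) blk′ xs≤m

  parkFrom-head : ∀ {occ t} xs → Unique occ → IsBlock occ t → All (_≤ m) xs →
                  All (λ b → b < m ⊎ b ≡ t) (take 1 (parkFrom occ xs))
  parkFrom-head [] _ _ _ = []
  parkFrom-head (x ∷ xs) u blk (x≤m ∷ _) with block-step u blk x≤m
  ... | inj₁ (s<m , _) = inj₁ s<m ∷ []
  ... | inj₂ (s≡t , _) = inj₂ s≡t ∷ []

  DescentsBelow : List ℕ → Set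
  DescentsBelow = Linked (λ a b → b < a → b < m)

  parkFrom-descentsBelow : ∀ {occ t a} xs → Unique occ → IsBlock occ t → All (_≤ m) xs → a ∈ occ →
                           DescentsBelow (a ∷ parkFrom occ xs)
  parkFrom-descentsBelow [] _ _ _ _ = [-]
  parkFrom-descentsBelow (x ∷ xs) u blk (x≤m ∷ xs≤m) a∈ with block-step u blk x≤m
  ... | inj₁ (s<m , blk′) =
    (λ _ → s<m) ∷ parkFrom-descentsBelow xs (spot∷-unique x u) blk′ xs≤m (here refl)
  ... | inj₂ (s≡t , blk′) =
    (λ s<a → contradiction (All.lookup (<t blk) a∈) (<-asym (subst (_< _) s≡t s<a))) ∷
    parkFrom-descentsBelow xs (spot∷-unique x u) blk′ xs≤m (here refl)

  oc-descentsBelow : ∀ xs → All (_≤ m) xs → DescentsBelow (oc xs)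
  oc-descentsBelow [] _ = []
  oc-descentsBelow (x ∷ xs) (x≤m ∷ xs≤m) =
    parkFrom-descentsBelow xs (spot∷-unique x []) (proj₂ (block-occupied (x ∷ []) [] block-[] (x≤m ∷ [])))
                           xs≤m (here refl)

  punchIn : ℕ → ℕ
  punchIn u with u <? m
  ... | yes _ = u
  ... | no _ = suc u

  punchIn-< : ∀ {u} → u < m → punchIn u ≡ u
  punchIn-< {u} u<m with u <? m
  ... | yes _ = refl
  ... | no u≮m = contradiction u<m u≮m

  punchIn-≥ : ∀ {u} → m ≤ u → punchIn u ≡ suc u
  punchIn-≥ {u} m≤u with u <? m
  ... | yes u<m = contradiction m≤u (<⇒≱ u<m)
  ... | no _ = refl

  punchIn-≢ : ∀ u → punchIn u ≢ m
  punchIn-≢ u with u <? m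
  ... | yes u<m = <⇒≢ u<m
  ... | no u≮m = <⇒≢ (s≤s (≮⇒≥ u≮m)) ∘ sym

  ≤-punchIn : ∀ u → u ≤ punchIn u
  ≤-punchIn u with u <? m
  ... | yes _ = ≤-refl
  ... | no _ = n≤1+n u

  punchIn-≤-suc : ∀ u → punchIn u ≤ suc u
  punchIn-≤-suc u with u <? m
  ... | yes _ = n≤1+n u
  ... | no _ = ≤-refl

  punchIn-≤⁻ : ∀ {x v} → x ≤ m → x ≤ punchIn v → x ≤ v
  punchIn-≤⁻ {v = v} x≤m x≤ with v <? m
  ... | yes _ = x≤
  ... | no v≮m = ≤-trans x≤m (≮⇒≥ v≮m)

  punchIn-<-⇔ : ∀ u v → u < v ⇔ punchIn u < punchIn v
  punchIn-<-⇔ u v with u <? m | v <? m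
  ... | yes _ | yes _ = mk⇔ (λ u<v → u<v) (λ u<v → u<v)
  ... | yes u<m | no v≮m = mk⇔ (λ _ → <-≤-trans u<m (≤-trans (≮⇒≥ v≮m) (n≤1+n v)))
                               (λ _ → <-≤-trans u<m (≮⇒≥ v≮m))
  ... | no u≮m | yes v<m = mk⇔ (λ u<v → contradiction (<-trans u<v v<m) u≮m)
                               (λ 1+u<v → contradiction (<-trans (<-trans (n<1+n u) 1+u<v) v<m) u≮m)
  ... | no _ | no _ = mk⇔ s≤s ≤-pred

  punchIn-injective : ∀ {u v} → punchIn u ≡ punchIn v → u ≡ v
  punchIn-injective {u} {v} e with <-cmp u v
  ... | tri< u<v _ _ = contradiction e (<⇒≢ (to (punchIn-<-⇔ u v) u<v))
  ... | tri≈ _ u≡v _ = u≡v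
  ... | tri> _ _ v<u = contradiction (sym e) (<⇒≢ (to (punchIn-<-⇔ v u) v<u))

  punchIn-surjective : ∀ {u} → u ≢ m → ∃ λ v → punchIn v ≡ u
  punchIn-surjective {u} u≢m with <-cmp u m
  ... | tri< u<m _ _ = u , punchIn-< u<m
  ... | tri≈ _ u≡m _ = contradiction u≡m u≢m
  ... | tri> _ _ m<u with u
  ...   | suc v = v , punchIn-≥ (≤-pred m<u)

  punchIn-image-unique : ∀ {occ} → Unique occ → Unique (m ∷ map punchIn occ)
  punchIn-image-unique {occ} u =
    All.map⁺ (All.tabulate {xs = occ} λ {v} _ → punchIn-≢ v ∘ sym) ∷ Unique.map⁺ punchIn-injective u

  leastFree-punchIn : ∀ {occ x s} → x ≤ m → LeastFree occ x s →
                      LeastFree (m ∷ map punchIn occ) x (punchIn s)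
  leastFree-punchIn {occ} {x} {s} x≤m (leastFree x≤s s∉ filled) =
    leastFree (≤-trans x≤s (≤-punchIn s)) free filled′
    where
    free : punchIn s ∉ m ∷ map punchIn occ
    free (here e) = punchIn-≢ s e
    free (there s∈) with ∈-map⁻ punchIn s∈
    ... | v , v∈ , e = s∉ (subst (_∈ occ) (sym (punchIn-injective e)) v∈)
    filled′ : ∀ {u} → x ≤ u → u < punchIn s → u ∈ m ∷ map punchIn occ
    filled′ {u} x≤u u< with u ≟ m
    ... | yes refl = here refl
    ... | no u≢m with punchIn-surjective u≢m
    ...   | v , refl = there (∈-map⁺ punchIn (filled (punchIn-≤⁻ x≤m x≤u) (from (punchIn-<-⇔ v s) u<)))

  -- Once the car preferring m has taken the top t of the block, the occupied
  -- spots are {m} ∪ punchIn(occ), and every later car parks at the punchIn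
  -- image of the spot it would have taken.
  block-↭ : ∀ {occ t} → Unique occ → IsBlock occ t → t ∷ occ ↭ m ∷ map punchIn occ
  block-↭ {occ} {t} u blk =
    unique-⊆⇒↭ (¬Any⇒All¬ occ (λ t∈ → <-irrefl refl (All.lookup (<t blk) t∈)) ∷ u) ⊆image
               (cong suc (length-map punchIn occ))
    where
    shifted : ∀ {u} → m < u → u ≤ t → u ∈ m ∷ map punchIn occ
    shifted {suc v} m<u u≤t =
      there (subst (_∈ _) (punchIn-≥ (≤-pred m<u)) (∈-map⁺ punchIn (filled blk (≤-pred m<u) u≤t)))
    ⊆image : t ∷ occ ⊆ m ∷ map punchIn occ
    ⊆image {u} u∈ with <-cmp u m | u∈
    ... | tri≈ _ refl _ | _ = here refl
    ... | tri> _ _ m<u | here refl = shifted m<u ≤-refl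
    ... | tri> _ _ m<u | there u∈occ = shifted m<u (<⇒≤ (All.lookup (<t blk) u∈occ))
    ... | tri< u<m _ _ | here refl = contradiction (m≤t blk) (<⇒≱ u<m)
    ... | tri< u<m _ _ | there u∈occ = there (subst (_∈ _) (punchIn-< u<m) (∈-map⁺ punchIn u∈occ))

  parkFrom-punchIn : ∀ {occ occ₂} xs → Unique occ → occ₂ ↭ m ∷ map punchIn occ → All (_≤ m) xs →
                     parkFrom occ₂ xs ≡ map punchIn (parkFrom occ xs)
  parkFrom-punchIn [] _ _ _ = refl
  parkFrom-punchIn {occ} {occ₂} (x ∷ xs) u occ₂↭ (x≤m ∷ xs≤m) =
    cong₂ _∷_ spot≡ (parkFrom-punchIn xs (spot∷-unique x u) occ₂′↭ xs≤m)
    where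
    spot≡ : spot occ₂ x ≡ punchIn (spot occ x)
    spot≡ = leastFree-unique (spot-leastFree x (Unique-resp-↭ (↭-sym occ₂↭) (punchIn-image-unique u)))
              (leastFree-resp-↭ (↭-sym occ₂↭) (leastFree-punchIn x≤m (spot-leastFree x u)))
    occ₂′↭ : spot occ₂ x ∷ occ₂ ↭ m ∷ map punchIn (spot occ x ∷ occ)
    occ₂′↭ = ↭-trans (prep (spot occ₂ x) occ₂↭)
                     (↭-trans (↭-reflexive (cong (λ s → s ∷ m ∷ _) spot≡)) (swap _ _ ↭-refl))

  oc-insertAt : ∀ i π → All (_≤ m) π →
    ∃ λ t → IsBlock (occupied [] (take i π)) t ×
            oc (insertAt i m π) ≡
            oc (take i π) ++ t ∷ map punchIn (parkFrom (occupied [] (take i π)) (drop i π))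
  oc-insertAt i π π≤m =
    let t , blk = block-occupied (take i π) [] block-[] (All.take⁺ i π≤m)
        uO = occupied-unique (take i π) []
    in t , blk , (begin
      parkFrom [] (take i π ++ m ∷ drop i π)
        ≡⟨ parkFrom-++ [] (take i π) (m ∷ drop i π) ⟩
      oc (take i π) ++ spot O m ∷ parkFrom (spot O m ∷ O) (drop i π)
        ≡⟨ cong (λ s → oc (take i π) ++ s ∷ parkFrom (s ∷ O) (drop i π)) (spot-m uO blk) ⟩
      oc (take i π) ++ t ∷ parkFrom (t ∷ O) (drop i π)
        ≡⟨ cong (λ σ → oc (take i π) ++ t ∷ σ)
                (parkFrom-punchIn (drop i π) uO (block-↭ uO blk) (All.drop⁺ i π≤m)) ⟩
      oc (take i π) ++ t ∷ map punchIn (parkFrom O (drop i π)) ∎)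
    where
    open ≡-Reasoning
    O = occupied [] (take i π)

  desFrom-punchIn : ∀ x ys → desFrom (punchIn x) (map punchIn ys) ≡ desFrom x ys
  desFrom-punchIn x [] = refl
  desFrom-punchIn x (y ∷ ys) = begin
    desFrom (punchIn x) (punchIn y ∷ map punchIn ys)
      ≡⟨ desFrom-∷ (punchIn x) (punchIn y) (map punchIn ys) ⟩
    ⟦ punchIn y <? punchIn x ⟧ + desFrom (punchIn y) (map punchIn ys)
      ≡⟨ cong₂ _+_ (sym (iverson-cong (y <? x) (punchIn y <? punchIn x) (punchIn-<-⇔ y x)))
                   (desFrom-punchIn y ys) ⟩
    ⟦ y <? x ⟧ + desFrom y ys
      ≡⟨ desFrom-∷ x y ys ⟨
    desFrom x (y ∷ ys) ∎
    where open ≡-Reasoning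

  startsBelow : List ℕ → ℕ
  startsBelow [] = 0
  startsBelow (y ∷ _) = ⟦ y <? m ⟧

  -- des σ, with the descent between positions i - 1 and i replaced by ⟦ σᵢ < m ⟧
  desInserted : ℕ → List ℕ → ℕ
  desInserted i σ = des (take i σ) + startsBelow (drop i σ) + des (drop i σ)

  desInserted-++ : ∀ ys zs → desInserted (length ys) (ys ++ zs) ≡ des ys + startsBelow zs + des zs
  desInserted-++ ys zs rewrite take-length-++ ys zs | drop-length-++ ys zs = refl

  punchIn-<-top : ∀ {b t} → m ≤ t → b < m ⊎ b ≡ t → punchIn b < t ⇔ b < m
  punchIn-<-top m≤t (inj₁ b<m) =
    mk⇔ (λ _ → b<m) (λ _ → subst (_< _) (sym (punchIn-< b<m)) (<-≤-trans b<m m≤t))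
  punchIn-<-top {b} m≤t (inj₂ refl) =
    mk⇔ (λ b<b → contradiction (subst (_< b) (punchIn-≥ m≤t) b<b) (<-asym (n<1+n b)))
        (λ b<m → contradiction m≤t (<⇒≱ b<m))

  des-++-top-punchIn : ∀ {t} ys zs → m ≤ t → All (_< t) ys → All (λ b → b < m ⊎ b ≡ t) (take 1 zs) →
                       des (ys ++ t ∷ map punchIn zs) ≡ des ys + startsBelow zs + des zs
  des-++-top-punchIn ys [] _ ys<t _ = ≡-trans (des-++-top ys [] ys<t) (sym (+-identityʳ _))
  des-++-top-punchIn {t} ys (b ∷ zs) m≤t ys<t (b-head ∷ []) = begin
    des (ys ++ t ∷ map punchIn (b ∷ zs))
      ≡⟨ des-++-top ys _ ys<t ⟩
    des ys + desFrom t (punchIn b ∷ map punchIn zs)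
      ≡⟨ cong (des ys +_) (desFrom-∷ t (punchIn b) (map punchIn zs)) ⟩
    des ys + (⟦ punchIn b <? t ⟧ + desFrom (punchIn b) (map punchIn zs))
      ≡⟨ cong (des ys +_) (cong₂ _+_ (iverson-cong (punchIn b <? t) (b <? m) (punchIn-<-top m≤t b-head))
                                     (desFrom-punchIn b zs)) ⟩
    des ys + (⟦ b <? m ⟧ + desFrom b zs)
      ≡⟨ +-assoc (des ys) _ _ ⟨
    des ys + ⟦ b <? m ⟧ + des (b ∷ zs) ∎
    where open ≡-Reasoning

  des-oc-insertAt : ∀ i π → All (_≤ m) π → i ≤ length π →
                    des (oc (insertAt i m π)) ≡ desInserted i (oc π)
  des-oc-insertAt i π π≤m i≤ with oc-insertAt i π π≤m
  ... | t , blk , oc≡ = begin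
    des (oc (insertAt i m π))             ≡⟨ cong des oc≡ ⟩
    des (σ₁ ++ t ∷ map punchIn σ₂)        ≡⟨ des-++-top-punchIn σ₁ σ₂ (m≤t blk) σ₁<t σ₂-head ⟩
    des σ₁ + startsBelow σ₂ + des σ₂      ≡⟨ desInserted-++ σ₁ σ₂ ⟨
    desInserted (length σ₁) (σ₁ ++ σ₂)    ≡⟨ cong₂ desInserted |σ₁|≡i (oc-take-drop i π) ⟩
    desInserted i (oc π)                  ∎
    where
    open ≡-Reasoning
    σ₁ = oc (take i π)
    σ₂ = parkFrom (occupied [] (take i π)) (drop i π)
    σ₁<t : All (_< t) σ₁
    σ₁<t = All.tabulate (All.lookup (<t blk) ∘ occupied-∈⁺ [] (take i π))
    σ₂-head = parkFrom-head (drop i π) (occupied-unique (take i π) []) blk (All.drop⁺ i π≤m)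
    |σ₁|≡i : length σ₁ ≡ i
    |σ₁|≡i = ≡-trans (length-parkFrom [] (take i π)) (length-take-≤ i π i≤)

  desInserted-∷ : ∀ i x y ys →
                  desInserted (suc (suc i)) (x ∷ y ∷ ys) ≡ ⟦ y <? x ⟧ + desInserted (suc i) (y ∷ ys)
  desInserted-∷ i x y ys =
    ≡-trans (cong (λ d → d + startsBelow (drop i ys) + des (drop i ys)) (desFrom-∷ x y (take i ys)))
            (≡-trans (cong (_+ des (drop i ys)) (+-assoc ⟦ y <? x ⟧ _ _)) (+-assoc ⟦ y <? x ⟧ _ _))

  desInserted-levels : ∀ x ys → DescentsBelow (x ∷ ys) →
    Levels (suc (length ys)) (countBelow m ys) (desFrom x ys)
           (applyUpTo (λ i → desInserted (suc i) (x ∷ ys)) (suc (length ys)))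
  desInserted-levels x [] _ = 1 , 0 , refl , refl , ↭-refl
  desInserted-levels x (y ∷ ys) (y<x⇒y<m ∷ below) =
    Levels-cong (sym (countBelow-∷ m y ys)) (sym (desFrom-∷ x y ys)) (sym slots≡)
      (levels-extend (y <? x) (y <? m) y<x⇒y<m (desInserted-levels y ys below))
    where
    slots≡ : applyUpTo (λ i → desInserted (suc i) (x ∷ y ∷ ys)) (suc (suc (length ys))) ≡
             (⟦ y <? m ⟧ + desFrom y ys) ∷
             map (⟦ y <? x ⟧ +_) (applyUpTo (λ i → desInserted (suc i) (y ∷ ys)) (suc (length ys)))
    slots≡ = cong ((⟦ y <? m ⟧ + desFrom y ys) ∷_)
      (≡-trans (applyUpTo-cong-< (suc (length ys)) (λ {i} _ → desInserted-∷ i x y ys))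
               (sym (map-applyUpTo (λ i → desInserted (suc i) (y ∷ ys)) (⟦ y <? x ⟧ +_) (suc (length ys)))))

  desInserted-levels₀ : ∀ σ → DescentsBelow σ →
    Levels (suc (length σ)) (countBelow m σ) (des σ) (applyUpTo (λ i → desInserted i σ) (suc (length σ)))
  desInserted-levels₀ [] _ = 1 , 0 , refl , refl , ↭-refl
  desInserted-levels₀ (x ∷ ys) below =
    Levels-cong (sym (countBelow-∷ m x ys)) refl refl (levels-cons (x <? m) (desInserted-levels x ys below))

-- Parking contents

record IsContent (n : ℕ) (c : ℕ → ℕ) : Set where
  field
    positive : ∀ {j} → j < n → 1 ≤ c j
    monotone : ∀ {i j} → i ≤ j → j < n → c i ≤ c j
    bounded  : ∀ {j} → j < n → c j ≤ suc j

open IsContent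

isContent-pred : ∀ {n c} → IsContent (suc n) c → IsContent n c
isContent-pred ic = record
  { positive = positive ic ∘ m<n⇒m<1+n
  ; monotone = λ i≤j j<n → monotone ic i≤j (m<n⇒m<1+n j<n)
  ; bounded  = bounded ic ∘ m<n⇒m<1+n
  }

map-content-positive : ∀ {n c} → IsContent n c → q ↭ upTo n → All (1 ≤_) (map c q)
map-content-positive ic q↭ = All.map⁺ (All.map (positive ic) (↭upTo⇒< q↭))

map-content-≤-last : ∀ {n c} → IsContent (suc n) c → q ↭ upTo n → All (_≤ c n) (map c q)
map-content-≤-last {n = n} ic q↭ =
  All.map⁺ (All.map (λ j<n → monotone ic (<⇒≤ j<n) (n<1+n n)) (↭upTo⇒< q↭))

oc-bounded : ∀ n {c} → IsContent n c → q ↭ upTo n → All (_≤ n) (oc (map c q))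
oc-bounded zero _ q↭ rewrite ↭-empty-inv q↭ = []
oc-bounded (suc n) {c} ic q↭ with ∈-insertions⁻ id-isReordering {n = n} (∈-insertions⁺ id-isReordering q↭)
... | q′ , i , q′↭ , _ , refl with InsertMax.oc-insertAt (c n) i (map c q′) (map-content-≤-last ic q′↭)
... | t , blk , oc≡ =
  subst (All (_≤ suc n)) (sym (≡-trans (cong oc (map-rearrangeAt id-isReordering c i n q′)) oc≡))
    (All.++⁺ (All.map m≤n⇒m≤1+n σ₁≤n)
             (t≤1+n ∷ All.map⁺ (All.map (λ {u} u≤n → ≤-trans (punchIn-≤-suc u) (s≤s u≤n)) σ₂≤n)))
  where
  open InsertMax (c n)
  σ₁ = oc (take i (map c q′))
  σ≤n = subst (All (_≤ n)) (sym (oc-take-drop i (map c q′))) (oc-bounded n (isContent-pred ic) q′↭)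
  σ₁≤n = All.++⁻ˡ σ₁ σ≤n
  σ₂≤n = All.++⁻ʳ σ₁ σ≤n
  t≤1+n : t ≤ suc n
  t≤1+n with t ≤? suc n
  ... | yes t≤ = t≤
  ... | no t≰ = contradiction (All.lookup σ₁≤n (occupied-∈⁻ (take i (map c q′)) 1+n∈)) 1+n≰n
    where 1+n∈ = IsBlock.filled blk (bounded ic (n<1+n n)) (≰⇒> t≰)

oc-↭-range : ∀ n {c q} → IsContent n c → q ↭ upTo n → oc (map c q) ↭ applyUpTo suc n
oc-↭-range n {c} {q} ic q↭ =
  unique-⊆⇒↭ (oc-unique (map c q)) ⊆range
    (≡-trans (length-applyUpTo suc n)
             (sym (≡-trans (length-parkFrom [] (map c q)) (≡-trans (length-map c q) (↭upTo⇒length q↭)))))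
  where
  ⊆range : oc (map c q) ⊆ applyUpTo suc n
  ⊆range u∈ with All.lookup (parkFrom-≥ [] (map-content-positive ic q↭)) u∈
                | All.lookup (oc-bounded n ic q↭) u∈
  ... | s≤s _ | u≤n = ∈-applyUpTo⁺ suc u≤n

countBelow-oc : ∀ {n c} → IsContent (suc n) c → q ↭ upTo n → countBelow (c n) (oc (map c q)) ≡ c n ∸ 1
countBelow-oc {n = n} ic q↭ =
  ≡-trans (countBelow-↭ _ (oc-↭-range n (isContent-pred ic) q↭)) (countBelow-range _ 1 n (bounded ic (n<1+n n)))

-- Equidistribution

excedStat desStat : (ℕ → ℕ) → List ℕ → ℕ
excedStat c q = exced (map c q)
desStat c q = des (oc (map c q))

excedStat-slots : ∀ {n c q} → IsContent (suc n) c → q ↭ upTo n →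
  applyUpTo (λ i → excedStat c (displaceAt i n q)) (suc n) ↭ spread (suc n) (c n ∸ 1) (excedStat c q)
excedStat-slots {n} {c} {q} ic q↭ = begin
  applyUpTo (λ i → excedStat c (displaceAt i n q)) (suc n)
    ≡⟨ applyUpTo-cong-< (suc n) (λ {i} _ → cong exced (map-rearrangeAt rotate-isReordering c i n q)) ⟩
  applyUpTo (λ i → exced (displaceAt i (c n) π)) (suc n)
    ≡⟨ cong (λ k → applyUpTo (λ i → exced (displaceAt i (c n) π)) (suc k)) |π|≡n ⟨
  applyUpTo (λ i → exced (displaceAt i (c n) π)) (suc (length π))
    ↭⟨ Levels⇒↭spread (displaceAt-excedFrom-levels 1 (c n) π (map-content-≤-last ic q↭)
                        (subst (λ k → c n ≤ suc k) (sym |π|≡n) (bounded ic (n<1+n n)))) ⟩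
  spread (suc (length π)) (c n ∸ 1) (exced π)
    ≡⟨ cong (λ k → spread (suc k) (c n ∸ 1) (exced π)) |π|≡n ⟩
  spread (suc n) (c n ∸ 1) (excedStat c q) ∎
  where
  open PermutationReasoning
  π = map c q
  |π|≡n : length π ≡ n
  |π|≡n = ≡-trans (length-map c q) (↭upTo⇒length q↭)

desStat-slots : ∀ {n c q} → IsContent (suc n) c → q ↭ upTo n →
  applyUpTo (λ i → desStat c (insertAt i n q)) (suc n) ↭ spread (suc n) (c n ∸ 1) (desStat c q)
desStat-slots {n} {c} {q} ic q↭ = begin
  applyUpTo (λ i → desStat c (insertAt i n q)) (suc n)
    ≡⟨ applyUpTo-cong-< (suc n) (λ {i} i<1+n →
         ≡-trans (cong (des ∘ oc) (map-rearrangeAt id-isReordering c i n q))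
                 (des-oc-insertAt i π π≤ (subst (i ≤_) (sym |π|≡n) (≤-pred i<1+n)))) ⟩
  applyUpTo (λ i → desInserted i σ) (suc n)
    ≡⟨ cong (λ k → applyUpTo (λ i → desInserted i σ) (suc k)) |σ|≡n ⟨
  applyUpTo (λ i → desInserted i σ) (suc (length σ))
    ↭⟨ Levels⇒↭spread (desInserted-levels₀ σ (oc-descentsBelow π π≤)) ⟩
  spread (suc (length σ)) (countBelow (c n) σ) (des σ)
    ≡⟨ cong₂ (λ k M → spread (suc k) M (des σ)) |σ|≡n (countBelow-oc ic q↭) ⟩
  spread (suc n) (c n ∸ 1) (desStat c q) ∎
  where
  open PermutationReasoning
  open InsertMax (c n)
  π = map c q
  σ = oc π
  π≤ = map-content-≤-last ic q↭
  |π|≡n : length π ≡ n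
  |π|≡n = ≡-trans (length-map c q) (↭upTo⇒length q↭)
  |σ|≡n : length σ ≡ n
  |σ|≡n = ≡-trans (length-parkFrom [] π) |π|≡n

excedStat-↭-desStat : ∀ n {c} → IsContent n c →
                      map (excedStat c) (permutations n) ↭ map (desStat c) (permutations n)
excedStat-↭-desStat zero _ = ↭-refl
excedStat-↭-desStat (suc n) {c} ic = begin
  map (excedStat c) (permutations (suc n))
    ↭⟨ map-permutations-suc rotate-isReordering (excedStat c) (S ∘ excedStat c) (excedStat-slots ic) ⟩
  concatMap (S ∘ excedStat c) (permutations n)
    ≡⟨ concatMap-map S (excedStat c) (permutations n) ⟨
  concatMap S (map (excedStat c) (permutations n))
    ↭⟨ concatMap⁺ S (excedStat-↭-desStat n (isContent-pred ic)) ⟩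
  concatMap S (map (desStat c) (permutations n))
    ≡⟨ concatMap-map S (desStat c) (permutations n) ⟩
  concatMap (S ∘ desStat c) (permutations n)
    ↭⟨ map-permutations-suc id-isReordering (desStat c) (S ∘ desStat c) (desStat-slots ic) ⟨
  map (desStat c) (permutations (suc n)) ∎
  where
  open PermutationReasoning
  S = spread (suc n) (c n ∸ 1)

-- Back to vectors

entry : ∀ {n} → Vec ℕ n → ℕ → ℕ
entry [] _ = 0
entry (x ∷ b) zero = x
entry (x ∷ b) (suc j) = entry b j

entry-toℕ : ∀ {n} (b : Vec ℕ n) i → entry b (toℕ i) ≡ lookup b i
entry-toℕ (x ∷ b) Fin.zero = refl
entry-toℕ (x ∷ b) (Fin.suc i) = entry-toℕ b i

entry-isContent : ∀ {n} (b : Vec ℕ n) → IsParkingContent b → IsContent n (entry b)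
entry-isContent b pc = record
  { positive = λ j<n → subst (1 ≤_) (entry≡ j<n) (IsParkingContent.positive pc (fromℕ< j<n))
  ; monotone = λ i≤j j<n → subst₂ _≤_ (entry≡ (≤-<-trans i≤j j<n)) (entry≡ j<n)
      (IsParkingContent.increasing pc (fromℕ< (≤-<-trans i≤j j<n)) (fromℕ< j<n)
        (subst₂ _≤_ (sym (Fin.toℕ-fromℕ< _)) (sym (Fin.toℕ-fromℕ< _)) i≤j))
  ; bounded = λ j<n → subst₂ _≤_ (entry≡ j<n) (cong suc (Fin.toℕ-fromℕ< j<n))
      (IsParkingContent.bounded pc (fromℕ< j<n))
  }
  where
  entry≡ : ∀ {j} (j<n : j < _) → lookup b (fromℕ< j<n) ≡ entry b j
  entry≡ j<n = ≡-trans (sym (entry-toℕ b (fromℕ< j<n))) (cong (entry b) (Fin.toℕ-fromℕ< j<n))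

toList-map-lookup : ∀ {n k} (b : Vec ℕ n) (w : Vec (Fin n) k) →
                    toList (V.map (lookup b) w) ≡ map (entry b) (oneLine w)
toList-map-lookup b [] = refl
toList-map-lookup b (i ∷ w) = cong₂ _∷_ (sym (entry-toℕ b i)) (toList-map-lookup b w)

map-piBW : ∀ {n} (b : Vec ℕ n) (stat : List ℕ → ℕ) →
  map (λ w → stat (piBW b w)) (symmetricGroup n) ≡ map (stat ∘ map (entry b)) (permutations n)
map-piBW {n} b stat =
  ≡-trans (map-cong (λ w → cong stat (toList-map-lookup b w)) (symmetricGroup n)) (map-∘ (symmetricGroup n))

coeff-↭ : ∀ {n} (f g : Vec (Fin n) n → ℕ) → map f (symmetricGroup n) ↭ map g (symmetricGroup n) →
          ∀ k → coeff f k ≡ coeff g k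
coeff-↭ {n} f g f↭g k = begin
  length (filter ((_≟ k) ∘ f) (symmetricGroup n))   ≡⟨ length-filter-map (_≟ k) f (symmetricGroup n) ⟩
  length (filter (_≟ k) (map f (symmetricGroup n))) ≡⟨ ↭-length (filter-↭ (_≟ k) f↭g) ⟩
  length (filter (_≟ k) (map g (symmetricGroup n))) ≡⟨ length-filter-map (_≟ k) g (symmetricGroup n) ⟨
  length (filter ((_≟ k) ∘ g) (symmetricGroup n))   ∎
  where open ≡-Reasoning

theorem3p1 : (n : ℕ) → 1 ≤ n → (b : Vec ℕ n) → IsParkingContent b →
    (k : ℕ) → excedPoly b k ≡ desPoly b k
theorem3p1 n _ b pc = coeff-↭ _ _ (begin
  map (λ w → exced (piBW b w)) (symmetricGroup n)      ≡⟨ map-piBW b exced ⟩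
  map (excedStat (entry b)) (permutations n)           ↭⟨ excedStat-↭-desStat n (entry-isContent b pc) ⟩
  map (desStat (entry b)) (permutations n)             ≡⟨ map-piBW b (des ∘ oc) ⟨
  map (λ w → des (oc (piBW b w))) (symmetricGroup n)   ∎)
  where open PermutationReasoning
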